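{- Let $\Lambda$ be a non-ordinary numerical semigroup with enumeration $\lambda$ and conductor $c$, and for each $i$ let $\nu_i=\#\{j\in\mathbb{N}_0:\lambda_i-\lambda_j\in\Lambda\}$. Then a non-gap $\lambda_k\neq 2\lambda_1$ is a strong generator of $\Lambda$ if and only if $\lambda_k\geq c$ and $\nu_{k+\lambda_1}=4$.
   Context: A numerical semigroup is a subset $\Lambda\subseteq\mathbb{N}_0$ containing $0$, closed under addition, with finite complement; gaps are elements of $\mathbb{N}_0\setminus\Lambda$, non-gaps are elements of $\Lambda$, the conductor $c$ is the smallest integer such that all integers $\geq c$ lie in $\Lambda$. The enumeration is the increasing bijection $\lambda:\mathbb{N}_0\to\Lambda$, $i\mapsto\lambda_i$. $\Lambda$ is ordinary if $\Lambda=\{0\}\cup[c,\infty)$. Generators are elements of the minimal generating set. For a non-ordinary $\Lambda$, the effective generators are the generators that are $\geq c$. If $\lambda_{i_1}<\dots<\lambda_{i_n}$ are the effective generators of $\Lambda$, the effective generator $\lambda_{i_j}$ is called strong if the set of effective generators (generators greater than or equal to the conductor) of the numerical semigroup $\Lambda\setminus\{\lambda_{i_j}\}$ is $\{\lambda_{i_{j+1}},\dots,\lambda_{i_n},\lambda_{i_j}+\lambda_1\}$; an effective generator that is not strong is called weak. -}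

module Defs where

open import Data.Nat using (ℕ; zero; suc; _+_; _*_; _∸_; _≤_; _<_)
open import Data.List using (List; length; filter; upTo)
open import Data.Product using (Σ; ∃; _×_; _,_)
open import Data.Sum using (_⊎_)
open import Data.Empty using (⊥)
open import Relation.Nullary using (¬_; Dec; yes; no)
open import Relation.Nullary.Decidable using (_×-dec_)
open import Relation.Unary using (Pred; Decidable)
open import Relation.Binary.PropositionalEquality using (_≡_; _≢_)
open import Function.Bundles using (_⇔_)
open import Level using (0ℓ)

record NumericalSemigroup : Set₁ where
  field
    _∈Λ      : Pred ℕ 0ℓ
    _∈Λ?     : Decidable _∈Λ
    zero∈Λ   : 0 ∈Λ
    +-closed : ∀ {x y} → x ∈Λ → y ∈Λ → (x + y) ∈Λ
    cofinite : ∃ λ b → ∀ n → b ≤ n → n ∈Λ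

IsConductor : Pred ℕ 0ℓ → ℕ → Set
IsConductor P c =
  (∀ n → c ≤ n → P n) × (∀ c′ → (∀ n → c′ ≤ n → P n) → c ≤ c′)

IsGenerator : Pred ℕ 0ℓ → ℕ → Set
IsGenerator P x =
  P x × x ≢ 0 ×
  ¬ (Σ ℕ λ a → Σ ℕ λ b → P a × P b × a ≢ 0 × b ≢ 0 × a + b ≡ x)

IsEffectiveGenerator : Pred ℕ 0ℓ → ℕ → ℕ → Set
IsEffectiveGenerator P c x = IsGenerator P x × c ≤ x

IsOrdinary : Pred ℕ 0ℓ → ℕ → Set
IsOrdinary P c = ∀ n → P n ⇔ (n ≡ 0 ⊎ c ≤ n)

remove : Pred ℕ 0ℓ → ℕ → Pred ℕ 0ℓ
remove P g n = P n × n ≢ g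

module _ (Λ : NumericalSemigroup) where
  open NumericalSemigroup Λ

  IsEnumeration : (ℕ → ℕ) → Set
  IsEnumeration λ′ =
    (∀ i j → i < j → λ′ i < λ′ j) ×
    (∀ i → λ′ i ∈Λ) ×
    (∀ x → x ∈Λ → ∃ λ i → λ′ i ≡ x)

  -- Since λ_i - λ_j < 0 (hence ∉ Λ)
  -- for j > i, it suffices to count j ∈ {0,…,i}; the condition λ_j ≤ λ_i
  -- makes the truncated subtraction agree with integer subtraction.
  ν : (ℕ → ℕ) → ℕ → ℕ
  ν λ′ i = length (filter dec (upTo (suc i)))
    where
    dec : Decidable (λ j → λ′ j ≤ λ′ i × (λ′ i ∸ λ′ j) ∈Λ)
    dec j = (λ′ j Data.Nat.≤? λ′ i) ×-dec ((λ′ i ∸ λ′ j) ∈Λ?)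

  IsStrongGenerator : (ℕ → ℕ) → ℕ → ℕ → Set
  IsStrongGenerator λ′ c g =
    IsEffectiveGenerator _∈Λ c g ×
    Σ ℕ (λ c′ → IsConductor (remove _∈Λ g) c′ ×
      (∀ x → IsEffectiveGenerator (remove _∈Λ g) c′ x ⇔
             ((IsEffectiveGenerator _∈Λ c x × g < x) ⊎ x ≡ g + λ′ 1)))

-- Write g = λ_k ≥ c and m = λ₁.  Past the conductor the enumeration is a shift, so
-- λ_{k+m} = g + m, and ν_{k+m} counts the elements of Λ dividing g + m in Λ, i.e. the
-- splittings of g + m into two elements of Λ.  Four of them always exist (0, m, g and
-- g + m on the left), so ν_{k+m} = 4 says exactly that g + m is irreducible in Λ ∖ {g}.
-- That irreducibility is the whole content of strength: the effective generators of
-- Λ ∖ {g} other than g + m are those of Λ above g, because a sum x = g + y with y ≠ m can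
-- be rewritten as m + (g + (y − m)) inside Λ ∖ {g}; and when g ≠ 2m, a splitting g = a + b
-- with a ≠ m would give the splitting g + m = a + (b + m) inside Λ ∖ {g}.
module Submission where

open import Defs
open import Data.Nat using (ℕ; zero; suc; _+_; _*_; _∸_; _≤_; _<_; z≤n; s≤s; _≟_; _≤?_)
open import Data.Nat.Properties
open import Data.List using (length; filter; upTo; [_]; _++_)
open import Data.List.Properties using (length-++; filter-++; filter-accept; filter-reject; upTo-∷ʳ)
open import Data.Product using (Σ; ∃; _×_; _,_; proj₁; proj₂)
open import Data.Sum using (_⊎_; inj₁; inj₂)
open import Data.Empty using (⊥-elim)
open import Relation.Nullary using (¬_; Dec; yes; no; contradiction)
open import Relation.Nullary.Decidable using (_×-dec_)
open import Relation.Unary using (Pred; Decidable)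
open import Relation.Binary.PropositionalEquality hiding ([_])
open import Relation.Binary.Definitions using (tri<; tri≈; tri>)
open import Function.Bundles using (_⇔_; mk⇔; Equivalence)
import Function.Properties.Equivalence as ⇔
open import Level using (0ℓ)

Decomposable : Pred ℕ 0ℓ → Pred ℕ 0ℓ
Decomposable P x = Σ ℕ λ a → Σ ℕ λ b → P a × P b × a ≢ 0 × b ≢ 0 × a + b ≡ x

remove-conductor : ∀ {P c g} → (∀ n → c ≤ n → P n) → c ≤ g → IsConductor (remove P g) (suc g)
remove-conductor {g = g} above c≤g =
  (λ n g<n → above n (≤-trans c≤g (<⇒≤ g<n)) , >⇒≢ g<n) ,
  (λ c′ above′ → ≰⇒> (λ c′≤g → proj₂ (above′ g c′≤g) refl))

module Count {P : Pred ℕ 0ℓ} (P? : Decidable P) where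

  count : ℕ → ℕ
  count n = length (filter P? (upTo n))

  count-suc : ∀ n → count (suc n) ≡ count n + length (filter P? [ n ])
  count-suc n = begin
    length (filter P? (upTo (suc n)))
      ≡⟨ cong (λ xs → length (filter P? xs)) (sym (upTo-∷ʳ n)) ⟩
    length (filter P? (upTo n ++ [ n ]))
      ≡⟨ cong length (filter-++ P? (upTo n) [ n ]) ⟩
    length (filter P? (upTo n) ++ filter P? [ n ])
      ≡⟨ length-++ (filter P? (upTo n)) ⟩
    count n + length (filter P? [ n ]) ∎
    where open ≡-Reasoning

  count-suc-accept : ∀ {n} → P n → count (suc n) ≡ suc (count n)
  count-suc-accept {n} p = begin
    count (suc n)                       ≡⟨ count-suc n ⟩
    count n + length (filter P? [ n ])  ≡⟨ cong (λ xs → count n + length xs) (filter-accept P? p) ⟩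
    count n + 1                         ≡⟨ +-comm (count n) 1 ⟩
    suc (count n)                       ∎
    where open ≡-Reasoning

  count-suc-reject : ∀ {n} → ¬ P n → count (suc n) ≡ count n
  count-suc-reject {n} ¬p = begin
    count (suc n)                       ≡⟨ count-suc n ⟩
    count n + length (filter P? [ n ])  ≡⟨ cong (λ xs → count n + length xs) (filter-reject P? ¬p) ⟩
    count n + 0                         ≡⟨ +-identityʳ (count n) ⟩
    count n                             ∎
    where open ≡-Reasoning

  count-mono : ∀ {i n} → i ≤ n → count i ≤ count n
  count-mono {n = zero} z≤n = ≤-refl
  count-mono {i} {suc n} i≤1+n with m≤n⇒m<n∨m≡n i≤1+n
  ... | inj₂ refl = ≤-refl
  ... | inj₁ (s≤s i≤n) =
    ≤-trans (count-mono i≤n) (subst (count n ≤_) (sym (count-suc n)) (m≤m+n _ _))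

  count-accept-< : ∀ {i n} → P i → i < n → suc (count i) ≤ count n
  count-accept-< p i<n = ≤-trans (≤-reflexive (sym (count-suc-accept p))) (count-mono i<n)

  count-constant : ∀ {a b} → a ≤ b → (∀ j → a ≤ j → j < b → ¬ P j) → count b ≡ count a
  count-constant {b = zero} z≤n _ = refl
  count-constant {a} {suc b} a≤1+b none with m≤n⇒m<n∨m≡n a≤1+b
  ... | inj₂ refl = refl
  ... | inj₁ (s≤s a≤b) =
    trans (count-suc-reject (none b a≤b ≤-refl))
          (count-constant a≤b (λ j a≤j j<b → none j a≤j (m<n⇒m<1+n j<b)))

  count≡4⇔ : ∀ {k n} → 1 < k → k < n → P 0 → P 1 → P k → P n →
             count (suc n) ≡ 4 ⇔ (∀ j → j < n → P j → j ≤ 1 ⊎ j ≡ k)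
  count≡4⇔ {k} {n} 1<k k<n p₀ p₁ pₖ pₙ = mk⇔ only-0-1-k count≡4
    where
    count-2 : count 2 ≡ 2
    count-2 = trans (count-suc-accept p₁) (cong suc (count-suc-accept p₀))

    5≤count : ∀ {a b} → 1 < a → a < b → b < n → P a → P b → 5 ≤ count (suc n)
    5≤count {a} {b} 1<a a<b b<n pa pb = begin
      5              ≡⟨ cong (3 +_) (sym count-2) ⟩
      3 + count 2    ≤⟨ +-monoʳ-≤ 3 (count-mono 1<a) ⟩
      3 + count a    ≤⟨ +-monoʳ-≤ 2 (count-accept-< pa a<b) ⟩
      2 + count b    ≤⟨ +-monoʳ-≤ 1 (count-accept-< pb b<n) ⟩
      1 + count n    ≤⟨ count-accept-< pₙ ≤-refl ⟩
      count (suc n)  ∎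
      where open ≤-Reasoning

    only-0-1-k : count (suc n) ≡ 4 → ∀ j → j < n → P j → j ≤ 1 ⊎ j ≡ k
    only-0-1-k count≡4 j j<n pj with j ≤? 1 | j ≟ k
    ... | yes j≤1 | _       = inj₁ j≤1
    ... | no _    | yes j≡k = inj₂ j≡k
    ... | no j≰1  | no j≢k  = contradiction (subst (5 ≤_) count≡4 five) (<⇒≱ (n<1+n 4))
      where
      five : 5 ≤ count (suc n)
      five with <-cmp j k
      ... | tri< j<k _ _ = 5≤count (≰⇒> j≰1) j<k k<n pj pₖ
      ... | tri≈ _ j≡k _ = contradiction j≡k j≢k
      ... | tri> _ _ k<j = 5≤count 1<k k<j j<n pₖ pj

    count≡4 : (∀ j → j < n → P j → j ≤ 1 ⊎ j ≡ k) → count (suc n) ≡ 4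
    count≡4 only = begin
      count (suc n)        ≡⟨ count-suc-accept pₙ ⟩
      suc (count n)        ≡⟨ cong suc (count-constant k<n (λ j k<j j<n → none j (<-trans 1<k k<j) (>⇒≢ k<j) j<n)) ⟩
      suc (count (suc k))  ≡⟨ cong suc (count-suc-accept pₖ) ⟩
      2 + count k          ≡⟨ cong (2 +_) (count-constant 1<k (λ j 1<j j<k → none j 1<j (<⇒≢ j<k) (<-trans j<k k<n))) ⟩
      2 + count 2          ≡⟨ cong (2 +_) count-2 ⟩
      4                    ∎
      where
      open ≡-Reasoning
      none : ∀ j → 1 < j → j ≢ k → j < n → ¬ P j
      none j 1<j j≢k j<n pj with only j j<n pj
      ... | inj₁ j≤1 = <⇒≱ 1<j j≤1
      ... | inj₂ j≡k = j≢k j≡k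

module EnumerationProperties (Λ : NumericalSemigroup) {λ′ : ℕ → ℕ} (en : IsEnumeration Λ λ′) where
  open NumericalSemigroup Λ

  enum-< : ∀ {i j} → i < j → λ′ i < λ′ j
  enum-< = proj₁ en _ _

  enum-∈ : ∀ i → λ′ i ∈Λ
  enum-∈ = proj₁ (proj₂ en)

  enum-surjective : ∀ {x} → x ∈Λ → ∃ λ i → λ′ i ≡ x
  enum-surjective = proj₂ (proj₂ en) _

  enum-≤ : ∀ {i j} → i ≤ j → λ′ i ≤ λ′ j
  enum-≤ i≤j with m≤n⇒m<n∨m≡n i≤j
  ... | inj₁ i<j  = <⇒≤ (enum-< i<j)
  ... | inj₂ refl = ≤-refl

  enum-cancel-< : ∀ {i j} → λ′ i < λ′ j → i < j
  enum-cancel-< λi<λj = ≰⇒> (λ j≤i → <⇒≱ λi<λj (enum-≤ j≤i))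

  enum-cancel-≤ : ∀ {i j} → λ′ i ≤ λ′ j → i ≤ j
  enum-cancel-≤ λi≤λj = ≮⇒≥ (λ j<i → <⇒≱ (enum-< j<i) λi≤λj)

  enum-injective : ∀ {i j} → λ′ i ≡ λ′ j → i ≡ j
  enum-injective eq = ≤-antisym (enum-cancel-≤ (≤-reflexive eq)) (enum-cancel-≤ (≤-reflexive (sym eq)))

  enum-zero : λ′ 0 ≡ 0
  enum-zero with enum-surjective zero∈Λ
  ... | i , λi≡0 = n≤0⇒n≡0 (subst (λ′ 0 ≤_) λi≡0 (enum-≤ z≤n))

  enum-one>0 : 0 < λ′ 1
  enum-one>0 = subst (_< λ′ 1) enum-zero (enum-< (s≤s z≤n))

  enum-one-minimal : ∀ {x} → x ∈Λ → x ≢ 0 → λ′ 1 ≤ x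
  enum-one-minimal x∈Λ x≢0 with enum-surjective x∈Λ
  ... | zero  , λ0≡x = contradiction (trans (sym λ0≡x) enum-zero) x≢0
  ... | suc i , λi≡x = subst (λ′ 1 ≤_) λi≡x (enum-≤ (s≤s z≤n))

  enum-shift : ∀ {c} → (∀ n → c ≤ n → n ∈Λ) → ∀ {k} → c ≤ λ′ k → ∀ i → λ′ (i + k) ≡ i + λ′ k
  enum-shift above {k} c≤λk zero = refl
  enum-shift above {k} c≤λk (suc i)
    with enum-surjective (above (suc (i + λ′ k)) (≤-trans c≤λk (m≤n+m (λ′ k) (suc i))))
  ... | t , λt≡1+i+λk = ≤-antisym upper lower
    where
    λ[i+k]≡i+λk : λ′ (i + k) ≡ i + λ′ k
    λ[i+k]≡i+λk = enum-shift above c≤λk i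
    upper : λ′ (suc (i + k)) ≤ suc (i + λ′ k)
    upper = subst (λ′ (suc (i + k)) ≤_) λt≡1+i+λk
      (enum-≤ (enum-cancel-< (subst₂ _<_ (sym λ[i+k]≡i+λk) (sym λt≡1+i+λk) ≤-refl)))
    lower : suc (i + λ′ k) ≤ λ′ (suc (i + k))
    lower = subst (λ z → suc z ≤ λ′ (suc (i + k))) λ[i+k]≡i+λk (enum-< ≤-refl)

module StrongGenerators (Λ : NumericalSemigroup) {λ′ : ℕ → ℕ} {c : ℕ}
  (en : IsEnumeration Λ λ′) (cd : IsConductor (NumericalSemigroup._∈Λ Λ) c)
  (non-ordinary : ¬ IsOrdinary (NumericalSemigroup._∈Λ Λ) c) where
  open NumericalSemigroup Λ
  open EnumerationProperties Λ en

  m : ℕ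
  m = λ′ 1

  m≢0 : m ≢ 0
  m≢0 = n>0⇒n≢0 enum-one>0

  ≥c⇒∈Λ : ∀ n → c ≤ n → n ∈Λ
  ≥c⇒∈Λ = proj₁ cd

  m<c : m < c
  m<c = ≰⇒> (λ c≤m → non-ordinary (λ n → mk⇔ (ordinary c≤m n) (from-ordinary n)))
    where
    from-ordinary : ∀ n → n ≡ 0 ⊎ c ≤ n → n ∈Λ
    from-ordinary n (inj₁ refl) = zero∈Λ
    from-ordinary n (inj₂ c≤n)  = ≥c⇒∈Λ n c≤n

    ordinary : c ≤ m → ∀ n → n ∈Λ → n ≡ 0 ⊎ c ≤ n
    ordinary c≤m n n∈Λ with n ≟ 0
    ... | yes n≡0 = inj₁ n≡0
    ... | no n≢0  = inj₂ (≤-trans c≤m (enum-one-minimal n∈Λ n≢0))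

  strong⇒ : ∀ {g} → IsStrongGenerator Λ λ′ c g → c ≤ g × ¬ Decomposable (remove _∈Λ g) (g + m)
  strong⇒ {g} ((_ , c≤g) , _ , _ , effective⇔) =
    c≤g , proj₂ (proj₂ (proj₁ (Equivalence.from (effective⇔ (g + m)) (inj₂ refl))))

  module _ {g : ℕ} (c≤g : c ≤ g) where

    m<g : m < g
    m<g = <-≤-trans m<c c≤g

    reroute : ∀ {x y} → y ∈Λ → y ≢ 0 → x ≢ g + m → g + y ≡ x → Decomposable (remove _∈Λ g) x
    reroute {x} {y} y∈Λ y≢0 x≢g+m g+y≡x =
      m , g + (y ∸ m) , (enum-∈ 1 , <⇒≢ m<g) ,
      (≥c⇒∈Λ _ (≤-trans c≤g (m≤m+n g _)) , >⇒≢ (m<m+n g (m<n⇒0<n∸m m<y))) ,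
      m≢0 , n>0⇒n≢0 (<-≤-trans (<-trans enum-one>0 m<g) (m≤m+n g _)) , m+[g+r]≡x
      where
      m<y : m < y
      m<y = ≤∧≢⇒< (enum-one-minimal y∈Λ y≢0) (λ m≡y → x≢g+m (trans (sym g+y≡x) (cong (g +_) (sym m≡y))))
      m+[g+r]≡x : m + (g + (y ∸ m)) ≡ x
      m+[g+r]≡x = begin
        m + (g + (y ∸ m))  ≡⟨ sym (+-assoc m g _) ⟩
        m + g + (y ∸ m)    ≡⟨ cong (_+ (y ∸ m)) (+-comm m g) ⟩
        g + m + (y ∸ m)    ≡⟨ +-assoc g m _ ⟩
        g + (m + (y ∸ m))  ≡⟨ cong (g +_) (m+[n∸m]≡n (<⇒≤ m<y)) ⟩
        g + y              ≡⟨ g+y≡x ⟩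
        x                  ∎
        where open ≡-Reasoning

    remove-effective⇒ : ∀ {x} → IsEffectiveGenerator (remove _∈Λ g) (suc g) x →
                        (IsEffectiveGenerator _∈Λ c x × g < x) ⊎ x ≡ g + m
    remove-effective⇒ {x} (((x∈Λ , _) , x≢0 , irreducible) , g<x) with x ≟ g + m
    ... | yes x≡g+m = inj₂ x≡g+m
    ... | no x≢g+m  = inj₁ (((x∈Λ , x≢0 , irreducible′) , ≤-trans c≤g (<⇒≤ g<x)) , g<x)
      where
      irreducible′ : ¬ Decomposable _∈Λ x
      irreducible′ (a , b , a∈Λ , b∈Λ , a≢0 , b≢0 , a+b≡x) with a ≟ g | b ≟ g
      ... | yes refl | _        = irreducible (reroute b∈Λ b≢0 x≢g+m a+b≡x)
      ... | no _     | yes refl = irreducible (reroute a∈Λ a≢0 x≢g+m (trans (+-comm g a) a+b≡x))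
      ... | no a≢g   | no b≢g   = irreducible (a , b , (a∈Λ , a≢g) , (b∈Λ , b≢g) , a≢0 , b≢0 , a+b≡x)

    generator⇒remove-effective : ∀ {x} → IsGenerator _∈Λ x → g < x →
                                 IsEffectiveGenerator (remove _∈Λ g) (suc g) x
    generator⇒remove-effective (x∈Λ , x≢0 , irreducible) g<x =
      ((x∈Λ , >⇒≢ g<x) , x≢0 ,
       λ { (a , b , (a∈Λ , _) , (b∈Λ , _) , rest) → irreducible (a , b , a∈Λ , b∈Λ , rest) }) ,
      g<x

    g+m-remove-effective : ¬ Decomposable (remove _∈Λ g) (g + m) →
                           IsEffectiveGenerator (remove _∈Λ g) (suc g) (g + m)
    g+m-remove-effective irreducible =
      ((≥c⇒∈Λ _ (≤-trans c≤g (m≤m+n g m)) , >⇒≢ g<g+m) , n>0⇒n≢0 (≤-<-trans z≤n g<g+m) , irreducible) ,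
      g<g+m
      where
      g<g+m : g < g + m
      g<g+m = m<m+n g enum-one>0

    generator : g ∈Λ → g ≢ 2 * m → ¬ Decomposable (remove _∈Λ g) (g + m) → IsGenerator _∈Λ g
    generator g∈Λ g≢2m irreducible =
      g∈Λ , n>0⇒n≢0 (<-trans enum-one>0 m<g) ,
      λ { (a , b , a∈Λ , b∈Λ , a≢0 , b≢0 , a+b≡g) → no-splitting a∈Λ b∈Λ a≢0 b≢0 a+b≡g }
      where
      add-m : ∀ {a b} → a ∈Λ → b ∈Λ → a ≢ 0 → b ≢ 0 → a ≢ m → a + b ≢ g
      add-m {a} {b} a∈Λ b∈Λ a≢0 b≢0 a≢m a+b≡g = irreducible
        (a , b + m , (a∈Λ , a≢g) , (+-closed b∈Λ (enum-∈ 1) , b+m≢g) , a≢0 ,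
         (λ b+m≡0 → b≢0 (m+n≡0⇒m≡0 b b+m≡0)) ,
         trans (sym (+-assoc a b m)) (cong (_+ m) a+b≡g))
        where
        a≢g : a ≢ g
        a≢g = <⇒≢ (subst (a <_) a+b≡g (m<m+n a (n≢0⇒n>0 b≢0)))
        b+m≢g : b + m ≢ g
        b+m≢g b+m≡g = a≢m (+-cancelʳ-≡ b a m (trans a+b≡g (sym (trans (+-comm m b) b+m≡g))))
      no-splitting : ∀ {a b} → a ∈Λ → b ∈Λ → a ≢ 0 → b ≢ 0 → a + b ≢ g
      no-splitting {a} {b} a∈Λ b∈Λ a≢0 b≢0 a+b≡g with a ≟ m
      ... | no a≢m  = add-m a∈Λ b∈Λ a≢0 b≢0 a≢m a+b≡g
      ... | yes refl = add-m b∈Λ a∈Λ b≢0 a≢0 b≢m (trans (+-comm b m) a+b≡g)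
        where
        b≢m : b ≢ m
        b≢m refl = g≢2m (trans (sym a+b≡g) (cong (m +_) (sym (+-identityʳ m))))

    strong⇐ : g ∈Λ → g ≢ 2 * m → ¬ Decomposable (remove _∈Λ g) (g + m) → IsStrongGenerator Λ λ′ c g
    strong⇐ g∈Λ g≢2m irreducible =
      (generator g∈Λ g≢2m irreducible , c≤g) , suc g , remove-conductor ≥c⇒∈Λ c≤g ,
      λ x → mk⇔ remove-effective⇒
        λ { (inj₁ ((x-generator , _) , g<x)) → generator⇒remove-effective x-generator g<x
          ; (inj₂ refl) → g+m-remove-effective irreducible }

  _≼_ : ℕ → ℕ → Set
  x ≼ y = x ≤ y × (y ∸ x) ∈Λ

  _≼?_ : ∀ x y → Dec (x ≼ y)
  x ≼? y = (x ≤? y) ×-dec ((y ∸ x) ∈Λ?)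

  +-≼ : ∀ {a b x} → b ∈Λ → a + b ≡ x → a ≼ x
  +-≼ {a} {b} b∈Λ a+b≡x =
    subst (a ≤_) a+b≡x (m≤m+n a b) ,
    subst _∈Λ (sym (trans (cong (_∸ a) (sym a+b≡x)) (m+n∸m≡n a b))) b∈Λ

  module _ {k : ℕ} (c≤λk : c ≤ λ′ k) where

    λ[k+m]≡λk+m : λ′ (k + m) ≡ λ′ k + m
    λ[k+m]≡λk+m = begin
      λ′ (k + m)  ≡⟨ cong λ′ (+-comm k m) ⟩
      λ′ (m + k)  ≡⟨ enum-shift ≥c⇒∈Λ c≤λk m ⟩
      m + λ′ k    ≡⟨ +-comm m (λ′ k) ⟩
      λ′ k + m    ∎
      where open ≡-Reasoning

    summand-index : ∀ {j b} → b ∈Λ → b ≢ 0 → λ′ j + b ≡ λ′ k + m → j < k + m × λ′ j ≼ λ′ (k + m)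
    summand-index {j} {b} b∈Λ b≢0 λj+b≡λk+m =
      enum-cancel-< (subst (λ′ j <_) λj+b≡λ[k+m] (m<m+n (λ′ j) (n≢0⇒n>0 b≢0))) ,
      +-≼ b∈Λ λj+b≡λ[k+m]
      where
      λj+b≡λ[k+m] : λ′ j + b ≡ λ′ (k + m)
      λj+b≡λ[k+m] = trans λj+b≡λk+m (sym λ[k+m]≡λk+m)

    trivial-divisors⇔irreducible :
      (∀ j → j < k + m → λ′ j ≼ λ′ (k + m) → j ≤ 1 ⊎ j ≡ k) ⇔
      (¬ Decomposable (remove _∈Λ (λ′ k)) (λ′ k + m))
    trivial-divisors⇔irreducible = mk⇔ irreducible trivial
      where
      irreducible : (∀ j → j < k + m → λ′ j ≼ λ′ (k + m) → j ≤ 1 ⊎ j ≡ k) →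
                    ¬ Decomposable (remove _∈Λ (λ′ k)) (λ′ k + m)
      irreducible only (a , b , (a∈Λ , a≢λk) , (b∈Λ , b≢λk) , a≢0 , b≢0 , a+b≡λk+m)
        with enum-surjective a∈Λ
      ... | j , refl with summand-index b∈Λ b≢0 a+b≡λk+m
      ... | j<k+m , λj≼ with only j j<k+m λj≼
      ... | inj₁ z≤n       = a≢0 enum-zero
      ... | inj₁ (s≤s z≤n) = b≢λk (+-cancelˡ-≡ m b (λ′ k) (trans a+b≡λk+m (+-comm (λ′ k) m)))
      ... | inj₂ refl      = a≢λk refl

      trivial : ¬ Decomposable (remove _∈Λ (λ′ k)) (λ′ k + m) →
                ∀ j → j < k + m → λ′ j ≼ λ′ (k + m) → j ≤ 1 ⊎ j ≡ k
      trivial irreducible j j<k+m (λj≤ , rest∈Λ) with j ≤? 1 | j ≟ k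
      ... | yes j≤1 | _       = inj₁ j≤1
      ... | no _    | yes j≡k = inj₂ j≡k
      ... | no j≰1  | no j≢k  = ⊥-elim (irreducible
        (λ′ j , rest , (enum-∈ j , λ λj≡λk → j≢k (enum-injective λj≡λk)) , (rest∈Λ , rest≢λk) ,
         n>0⇒n≢0 (<-trans enum-one>0 m<λj) , rest≢0 , λj+rest≡λk+m))
        where
        rest : ℕ
        rest = λ′ (k + m) ∸ λ′ j
        m<λj : m < λ′ j
        m<λj = enum-< (≰⇒> j≰1)
        λj+rest≡λk+m : λ′ j + rest ≡ λ′ k + m
        λj+rest≡λk+m = trans (m+[n∸m]≡n λj≤) λ[k+m]≡λk+m
        rest≢0 : rest ≢ 0
        rest≢0 rest≡0 = <⇒≱ j<k+m (enum-cancel-≤ (m∸n≡0⇒m≤n rest≡0))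
        rest≢λk : rest ≢ λ′ k
        rest≢λk rest≡λk = <⇒≢ m<λj (sym (+-cancelʳ-≡ (λ′ k) (λ′ j) m
          (trans (sym (cong (λ′ j +_) rest≡λk)) (trans λj+rest≡λk+m (+-comm (λ′ k) m)))))

    -- ν Λ λ′ (k + m) unfolds to the count of indices j ≤ k + m with λ′ j ≼ λ′ (k + m).
    ν≡4⇔irreducible : ν Λ λ′ (k + m) ≡ 4 ⇔ (¬ Decomposable (remove _∈Λ (λ′ k)) (λ′ k + m))
    ν≡4⇔irreducible =
      ⇔.trans (count≡4⇔ 1<k k<k+m λ0≼ λ1≼ λk≼ λ[k+m]≼) trivial-divisors⇔irreducible
      where
      open Count (λ j → λ′ j ≼? λ′ (k + m))
      1<k : 1 < k
      1<k = enum-cancel-< (<-≤-trans m<c c≤λk)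
      k<k+m : k < k + m
      k<k+m = m<m+n k enum-one>0
      λ0≼ : λ′ 0 ≼ λ′ (k + m)
      λ0≼ = subst (_≼ λ′ (k + m)) (sym enum-zero) (+-≼ (enum-∈ (k + m)) refl)
      λ1≼ : λ′ 1 ≼ λ′ (k + m)
      λ1≼ = +-≼ (enum-∈ k) (trans (+-comm m (λ′ k)) (sym λ[k+m]≡λk+m))
      λk≼ : λ′ k ≼ λ′ (k + m)
      λk≼ = +-≼ (enum-∈ 1) (sym λ[k+m]≡λk+m)
      λ[k+m]≼ : λ′ (k + m) ≼ λ′ (k + m)
      λ[k+m]≼ = +-≼ zero∈Λ (+-identityʳ _)

mainTheorem3 : (Λ : NumericalSemigroup) (λ′ : ℕ → ℕ) (c : ℕ) →
    IsEnumeration Λ λ′ →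
    IsConductor (NumericalSemigroup._∈Λ Λ) c →
    ¬ IsOrdinary (NumericalSemigroup._∈Λ Λ) c →
    ∀ k → λ′ k ≢ 2 * λ′ 1 →
    IsStrongGenerator Λ λ′ c (λ′ k) ⇔ (c ≤ λ′ k × ν Λ λ′ (k + λ′ 1) ≡ 4)
mainTheorem3 Λ λ′ c en cd non-ordinary k λk≢2m = mk⇔
  (λ strong → let c≤λk , irreducible = strong⇒ strong in
              c≤λk , Equivalence.from (ν≡4⇔irreducible c≤λk) irreducible)
  (λ (c≤λk , ν≡4) → strong⇐ c≤λk (enum-∈ k) λk≢2m (Equivalence.to (ν≡4⇔irreducible c≤λk) ν≡4))
  where
  open EnumerationProperties Λ en
  open StrongGenerators Λ en cd non-ordinary
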